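{- If $f(x_1,\ldots,x_n)$ is a Chow function, then every restriction of $f$ is also a Chow function.
   Context: The Chow parameters of $f(x_1,\ldots,x_n)$ are $(w_1(f),\ldots,w_n(f),w(f))$, where $w(f)$ is the number of true points of $f$ and $w_i(f)$ is the number of true points with $x_i=1$. $f$ is a Chow function if no other Boolean function of the same variables has the same Chow parameters. A restriction of $f$ is the function of the remaining variables obtained by fixing some variables $x_{i_1}=\alpha_1,\ldots,x_{i_k}=\alpha_k$, $\alpha_j\in\{0,1\}$. -}

module Defs where

open import Data.Nat using (ℕ; zero; suc)
open import Data.Bool using (Bool; true; false; _∧_)
open import Data.Fin using (Fin; zero; suc)
open import Data.Maybe using (Maybe; just; nothing)
open import Data.List using (List; []; _∷_; map; _++_)
open import Data.Nat.ListAction using (sum)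
open import Data.Vec using (Vec; []; _∷_)
open import Data.Product using (_×_)
open import Function using (_∘_)
open import Relation.Binary.PropositionalEquality using (_≡_)

BoolFun : ℕ → Set
BoolFun n = (Fin n → Bool) → Bool

cons : ∀ {n} → Bool → (Fin n → Bool) → (Fin (suc n) → Bool)
cons b x zero    = b
cons b x (suc i) = x i

points : (n : ℕ) → List (Fin n → Bool)
points zero    = (λ ()) ∷ []
points (suc n) = map (cons false) (points n) ++ map (cons true) (points n)

b2n : Bool → ℕ
b2n true  = 1
b2n false = 0

w : ∀ {n} → BoolFun n → ℕ
w {n} f = sum (map (λ x → b2n (f x)) (points n))

wᵢ : ∀ {n} → BoolFun n → Fin n → ℕ
wᵢ {n} f i = sum (map (λ x → b2n (f x ∧ x i)) (points n))

SameChow : ∀ {n} → BoolFun n → BoolFun n → Set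
SameChow f g = (∀ i → wᵢ f i ≡ wᵢ g i) × (w f ≡ w g)

IsChow : ∀ {n} → BoolFun n → Set
IsChow {n} f = (g : BoolFun n) → SameChow g f → ∀ x → g x ≡ f x

-- A restriction pattern: ρ i = just α fixes xᵢ = α, ρ i = nothing leaves xᵢ free.
-- number of free (remaining) variables
free : ∀ {n} → Vec (Maybe Bool) n → ℕ
free []            = zero
free (nothing ∷ ρ) = suc (free ρ)
free (just _ ∷ ρ)  = free ρ

fill : ∀ {n} (ρ : Vec (Maybe Bool) n) → (Fin (free ρ) → Bool) → (Fin n → Bool)
fill []            y = λ ()
fill (nothing ∷ ρ) y = cons (y zero) (fill ρ (y ∘ suc))
fill (just b ∷ ρ)  y = cons b (fill ρ y)

restrict : ∀ {n} → BoolFun n → (ρ : Vec (Maybe Bool) n) → BoolFun (free ρ)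
restrict f ρ y = f (fill ρ y)

-- Let g have the Chow parameters of the restriction f|ρ, and let F be f with its values on the
-- subcube fixed by ρ replaced by those of g.  On that subcube a coordinate xᵢ is either a constant
-- or a free variable xⱼ, so every Chow parameter of F differs from that of f by 0, w(g) − w(f|ρ)
-- or wⱼ(g) − wⱼ(f|ρ), all of which vanish.  As f is a Chow function, F = f, that is g = f|ρ.
--
-- Points are functions Fin n → Bool, and nothing forces a Boolean function to respect their
-- pointwise equality.  This also follows from f being Chow: two functions G, H that agree on the
-- enumerated points give the function (G xor H) xor f, which has the Chow parameters of f, so
-- G xor H is false everywhere.
module Submission where

open import Defs

open import Data.Bool using (Bool; true; false; _∧_; _xor_; if_then_else_)
open import Data.Bool.Properties using (∧-identityʳ; ∧-zeroʳ; xor-same)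
open import Data.Fin using (Fin; zero; suc)
open import Data.List using (_++_; map; head)
open import Data.List.Properties using (map-++; map-∘; map-cong; map-cong-local)
open import Data.List.Relation.Unary.All as All using (All; []; _∷_)
open import Data.List.Relation.Unary.All.Properties using (++⁺; map⁺)
open import Data.Maybe using (Maybe; just; nothing; fromMaybe)
open import Data.Nat using (ℕ; zero; suc; _+_; _≤′_; ≤′-refl; ≤′-step)
open import Data.Nat.ListAction using (sum)
open import Data.Nat.ListAction.Properties using (sum-++)
open import Data.Nat.Properties
  using (+-comm; +-assoc; +-cancelʳ-≡; z≤′n; s≤′s; +-commutativeSemigroup)
open import Algebra.Properties.CommutativeSemigroup +-commutativeSemigroup
  using (interchange; xy∙z≈xz∙y)
open import Data.Product using (∃-syntax; _,_)
open import Data.Sum using (_⊎_; inj₁; inj₂)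
open import Data.Vec using (Vec; []; _∷_)
open import Data.Vec.Functional using (tail)
open import Function using (_∘_; id; const)
open import Relation.Binary.PropositionalEquality
open ≡-Reasoning

infixr 6 _∧ᶠ_

_∧ᶠ_ : ∀ {n} → BoolFun n → BoolFun n → BoolFun n
(P ∧ᶠ Q) x = P x ∧ Q x

count : ∀ {n} → BoolFun n → ℕ
count {n} P = sum (map (λ x → b2n (P x)) (points n))

count-cong : ∀ {n} {P Q : BoolFun n} → P ≗ Q → count P ≡ count Q
count-cong {n} P≗Q = cong sum (map-cong (cong b2n ∘ P≗Q) (points n))

count-cong-points : ∀ {n} {P Q : BoolFun n} → All (λ x → P x ≡ Q x) (points n) →
                    count P ≡ count Q
count-cong-points P≈Q = cong sum (map-cong-local (All.map (cong b2n) P≈Q))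

count-cons : ∀ {n} (P : BoolFun (suc n)) →
             count P ≡ count (P ∘ cons false) + count (P ∘ cons true)
count-cons {n} P = begin
    sum (map u (map (cons false) xs ++ map (cons true) xs))
  ≡⟨ cong sum (map-++ u (map (cons false) xs) (map (cons true) xs)) ⟩
    sum (map u (map (cons false) xs) ++ map u (map (cons true) xs))
  ≡⟨ sum-++ (map u (map (cons false) xs)) (map u (map (cons true) xs)) ⟩
    sum (map u (map (cons false) xs)) + sum (map u (map (cons true) xs))
  ≡⟨ cong₂ _+_ (cong sum (map-∘ xs)) (cong sum (map-∘ xs)) ⟨
    count (P ∘ cons false) + count (P ∘ cons true)
  ∎
  where
  u  = λ x → b2n (P x)
  xs = points n

count-∧-true : ∀ {n} (P : BoolFun n) → count (P ∧ᶠ const true) ≡ count P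
count-∧-true P = count-cong (∧-identityʳ ∘ P)

PointsDetermine : ℕ → Set
PointsDetermine n =
  (G H : BoolFun n) → All (λ x → G x ≡ H x) (points n) → ∀ x → G x ≡ H x

Extensional : ∀ {n} → BoolFun n → Set
Extensional {n} h = ∀ {x y : Fin n → Bool} → x ≗ y → h x ≡ h y

xor-xor-≡⇒≡ : ∀ a b c → (a xor b) xor c ≡ c → a ≡ b
xor-xor-≡⇒≡ false false _     _  = refl
xor-xor-≡⇒≡ true  true  _     _  = refl
xor-xor-≡⇒≡ false true  false ()
xor-xor-≡⇒≡ false true  true  ()
xor-xor-≡⇒≡ true  false false ()
xor-xor-≡⇒≡ true  false true  ()

chow⇒pointsDetermine : ∀ {n} {f : BoolFun n} → IsChow f → PointsDetermine n
chow⇒pointsDetermine {n} {f} chow G H G≈H x = xor-xor-≡⇒≡ (G x) (H x) (f x) (chow F sameChow x)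
  where
  F : BoolFun n
  F x = (G x xor H x) xor f x

  F≈f : All (λ x → F x ≡ f x) (points n)
  F≈f = All.map (λ {x} Gx≡Hx → trans (cong (λ b → (b xor H x) xor f x) Gx≡Hx)
                                     (cong (_xor f x) (xor-same (H x))))
                G≈H

  sameChow : SameChow F f
  sameChow = (λ i → count-cong-points (All.map (cong (_∧ _)) F≈f))
           , count-cong-points F≈f

pointsDetermine-tail : ∀ {n} → PointsDetermine (suc n) → PointsDetermine n
pointsDetermine-tail pd G H G≈H x =
  pd (G ∘ tail) (H ∘ tail) (++⁺ (map⁺ G≈H) (map⁺ G≈H)) (cons false x)

pointsDetermine-≤′ : ∀ {m n} → m ≤′ n → PointsDetermine n → PointsDetermine m
pointsDetermine-≤′ ≤′-refl          = id
pointsDetermine-≤′ (≤′-step m≤′n) = pointsDetermine-≤′ m≤′n ∘ pointsDetermine-tail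

-- It must be the point listed in points 0: distinct absurd lambdas are not definitionally equal.
origin : Fin 0 → Bool
origin = fromMaybe (λ ()) (head (points 0))

normalise : ∀ {m} → (Fin m → Bool) → (Fin m → Bool)
normalise {zero}  _ = origin
normalise {suc m} x = cons (x zero) (normalise (tail x))

normalise-points : ∀ m → All (λ x → normalise x ≡ x) (points m)
normalise-points zero    = refl ∷ []
normalise-points (suc m) = ++⁺ (map⁺ (All.map (cong (cons false)) (normalise-points m)))
                               (map⁺ (All.map (cong (cons true)) (normalise-points m)))

normalise-cong : ∀ {m} {x y : Fin m → Bool} → x ≗ y → normalise x ≡ normalise y
normalise-cong {zero}  _   = refl
normalise-cong {suc m} x≗y = cong₂ cons (x≗y zero) (normalise-cong (x≗y ∘ suc))

pointsDetermine⇒extensional : ∀ {m} → PointsDetermine m → (h : BoolFun m) → Extensional h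
pointsDetermine⇒extensional {m} pd h {x} {y} x≗y = begin
  h x             ≡⟨ h≗h∘normalise x ⟩
  h (normalise x) ≡⟨ cong h (normalise-cong x≗y) ⟩
  h (normalise y) ≡⟨ h≗h∘normalise y ⟨
  h y             ∎
  where
  h≗h∘normalise : ∀ x → h x ≡ h (normalise x)
  h≗h∘normalise = pd h (h ∘ normalise) (All.map (cong h ∘ sym) (normalise-points m))

extensional-cons : ∀ {n} {h : BoolFun (suc n)} → Extensional h → ∀ b → Extensional (h ∘ cons b)
extensional-cons ext b x≗y = ext λ { zero → refl ; (suc i) → x≗y i }

free≤′ : ∀ {n} (ρ : Vec (Maybe Bool) n) → free ρ ≤′ n
free≤′ []            = ≤′-refl
free≤′ (nothing ∷ ρ) = s≤′s (free≤′ ρ)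
free≤′ (just _ ∷ ρ)  = ≤′-step (free≤′ ρ)

fill-coordinate : ∀ {n} (ρ : Vec (Maybe Bool) n) (i : Fin n) →
                  (∃[ b ] ∀ y → fill ρ y i ≡ b) ⊎ (∃[ j ] ∀ y → fill ρ y i ≡ y j)
fill-coordinate (just b  ∷ ρ) zero    = inj₁ (b , λ _ → refl)
fill-coordinate (just _  ∷ ρ) (suc i) = fill-coordinate ρ i
fill-coordinate (nothing ∷ ρ) zero    = inj₂ (zero , λ _ → refl)
fill-coordinate (nothing ∷ ρ) (suc i) with fill-coordinate ρ i
... | inj₁ (b , eq) = inj₁ (b , eq ∘ tail)
... | inj₂ (j , eq) = inj₂ (suc j , eq ∘ tail)

patch : ∀ {n} (ρ : Vec (Maybe Bool) n) → BoolFun n → BoolFun (free ρ) → BoolFun n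
patch []               f h   = h
patch (just true  ∷ ρ) f h x = if x zero then patch ρ (f ∘ cons true) h (tail x) else f x
patch (just false ∷ ρ) f h x = if x zero then f x else patch ρ (f ∘ cons false) h (tail x)
patch (nothing    ∷ ρ) f h x = patch ρ (f ∘ cons (x zero)) (h ∘ cons (x zero)) (tail x)

patch-fill : ∀ {n} (ρ : Vec (Maybe Bool) n) (f : BoolFun n) {h : BoolFun (free ρ)} →
             Extensional h → ∀ y → patch ρ f h (fill ρ y) ≡ h y
patch-fill []               f ext y = ext λ ()
patch-fill (just true  ∷ ρ) f ext y = patch-fill ρ (f ∘ cons true) ext y
patch-fill (just false ∷ ρ) f ext y = patch-fill ρ (f ∘ cons false) ext y
patch-fill (nothing    ∷ ρ) f ext y =
  trans (patch-fill ρ (f ∘ cons (y zero)) (extensional-cons ext (y zero)) (tail y))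
        (ext λ { zero → refl ; (suc i) → refl })

restrict-[] : {h : BoolFun 0} → Extensional h → restrict h [] ≗ h
restrict-[] ext _ = ext λ ()

count-∧-congʳ : ∀ {n} {P Q R : BoolFun n} → Q ≗ R → count (P ∧ᶠ Q) ≡ count (P ∧ᶠ R)
count-∧-congʳ {P = P} Q≗R = count-cong λ x → cong (P x ∧_) (Q≗R x)

sameChow-count-∧-const : ∀ {n} {g g′ : BoolFun n} → SameChow g g′ →
                         ∀ b → count (g ∧ᶠ const b) ≡ count (g′ ∧ᶠ const b)
sameChow-count-∧-const {g = g} {g′} (_ , w≡w) true  =
  trans (count-∧-true g) (trans w≡w (sym (count-∧-true g′)))
sameChow-count-∧-const {g = g} {g′} _         false =
  trans (count-cong (∧-zeroʳ ∘ g)) (sym (count-cong (∧-zeroʳ ∘ g′)))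

sameChow-count-∧-fill : ∀ {n} (ρ : Vec (Maybe Bool) n) {g g′ : BoolFun (free ρ)} →
                        SameChow g g′ → ∀ i →
                        count (g ∧ᶠ restrict (λ x → x i) ρ) ≡ count (g′ ∧ᶠ restrict (λ x → x i) ρ)
sameChow-count-∧-fill ρ same@(wᵢ≡wᵢ , _) i with fill-coordinate ρ i
... | inj₁ (b , eq) =
  trans (count-∧-congʳ eq) (trans (sameChow-count-∧-const same b) (sym (count-∧-congʳ eq)))
... | inj₂ (j , eq) =
  trans (count-∧-congʳ eq) (trans (wᵢ≡wᵢ j) (sym (count-∧-congʳ eq)))

module _ (ext₀ : (h : BoolFun 0) → Extensional h) where

  count-patch : ∀ {n} (ρ : Vec (Maybe Bool) n) (f : BoolFun n) (h : BoolFun (free ρ))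
                (c : BoolFun n) →
                count (patch ρ f h ∧ᶠ c) + count (restrict (f ∧ᶠ c) ρ) ≡
                count (f ∧ᶠ c) + count (h ∧ᶠ restrict c ρ)
  count-patch [] f h c = begin
    count (h ∧ᶠ c) + count (restrict (f ∧ᶠ c) [])  ≡⟨ +-comm (count (h ∧ᶠ c)) _ ⟩
    count (restrict (f ∧ᶠ c) []) + count (h ∧ᶠ c)
      ≡⟨ cong₂ _+_ (count-cong (restrict-[] (ext₀ (f ∧ᶠ c))))
                   (count-∧-congʳ {P = h} (sym ∘ restrict-[] (ext₀ c))) ⟩
    count (f ∧ᶠ c) + count (h ∧ᶠ restrict c [])    ∎
  count-patch (just true ∷ ρ) f h c = begin
    count P + r                             ≡⟨ cong (_+ r) (count-cons P) ⟩
    (a + count (patch ρ f₁ h ∧ᶠ c₁)) + r    ≡⟨ +-assoc a _ r ⟩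
    a + (count (patch ρ f₁ h ∧ᶠ c₁) + r)    ≡⟨ cong (a +_) (count-patch ρ f₁ h c₁) ⟩
    a + (count (f₁ ∧ᶠ c₁) + s)              ≡⟨ +-assoc a _ s ⟨
    (a + count (f₁ ∧ᶠ c₁)) + s              ≡⟨ cong (_+ s) (count-cons (f ∧ᶠ c)) ⟨
    count (f ∧ᶠ c) + s                      ∎
    where
    P  = patch (just true ∷ ρ) f h ∧ᶠ c
    f₁ = f ∘ cons true
    c₁ = c ∘ cons true
    a  = count ((f ∧ᶠ c) ∘ cons false)
    r  = count (restrict (f₁ ∧ᶠ c₁) ρ)
    s  = count (h ∧ᶠ restrict c₁ ρ)
  count-patch (just false ∷ ρ) f h c = begin
    count P + r                             ≡⟨ cong (_+ r) (count-cons P) ⟩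
    (count (patch ρ f₀ h ∧ᶠ c₀) + a) + r    ≡⟨ xy∙z≈xz∙y _ a r ⟩
    (count (patch ρ f₀ h ∧ᶠ c₀) + r) + a    ≡⟨ cong (_+ a) (count-patch ρ f₀ h c₀) ⟩
    (count (f₀ ∧ᶠ c₀) + s) + a              ≡⟨ xy∙z≈xz∙y _ a s ⟨
    (count (f₀ ∧ᶠ c₀) + a) + s              ≡⟨ cong (_+ s) (count-cons (f ∧ᶠ c)) ⟨
    count (f ∧ᶠ c) + s                      ∎
    where
    P  = patch (just false ∷ ρ) f h ∧ᶠ c
    f₀ = f ∘ cons false
    c₀ = c ∘ cons false
    a  = count ((f ∧ᶠ c) ∘ cons true)
    r  = count (restrict (f₀ ∧ᶠ c₀) ρ)
    s  = count (h ∧ᶠ restrict c₀ ρ)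
  count-patch (nothing ∷ ρ) f h c = begin
    count P + count R                          ≡⟨ cong₂ _+_ (count-cons P) (count-cons R) ⟩
    (p false + p true) + (r false + r true)    ≡⟨ interchange (p false) _ _ (r true) ⟩
    (p false + r false) + (p true + r true)    ≡⟨ cong₂ _+_ (half false) (half true) ⟩
    (q false + s false) + (q true + s true)    ≡⟨ interchange (q false) _ _ (s true) ⟩
    (q false + q true) + (s false + s true)    ≡⟨ cong₂ _+_ (count-cons (f ∧ᶠ c)) (count-cons S) ⟨
    count (f ∧ᶠ c) + count S                   ∎
    where
    P = patch (nothing ∷ ρ) f h ∧ᶠ c
    R = restrict (f ∧ᶠ c) (nothing ∷ ρ)
    S = h ∧ᶠ restrict c (nothing ∷ ρ)

    p r q s : Bool → ℕ
    p b = count (P ∘ cons b)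
    r b = count (R ∘ cons b)
    q b = count ((f ∧ᶠ c) ∘ cons b)
    s b = count (S ∘ cons b)

    half : ∀ b → p b + r b ≡ q b + s b
    half b = count-patch ρ (f ∘ cons b) (h ∘ cons b) (c ∘ cons b)

  patch-count : ∀ {n} (ρ : Vec (Maybe Bool) n) (f : BoolFun n) {g : BoolFun (free ρ)}
                (c : BoolFun n) →
                count (g ∧ᶠ restrict c ρ) ≡ count (restrict (f ∧ᶠ c) ρ) →
                count (patch ρ f g ∧ᶠ c) ≡ count (f ∧ᶠ c)
  patch-count ρ f {g} c eq =
    +-cancelʳ-≡ _ _ _ (trans (count-patch ρ f g c) (cong (count (f ∧ᶠ c) +_) eq))

  patch-sameChow : ∀ {n} (ρ : Vec (Maybe Bool) n) (f : BoolFun n) {g : BoolFun (free ρ)} →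
                   SameChow g (restrict f ρ) → SameChow (patch ρ f g) f
  patch-sameChow ρ f {g} same =
      (λ i → patch-count ρ f (λ x → x i) (sameChow-count-∧-fill ρ same i))
    , (begin
        w (patch ρ f g)                    ≡⟨ count-∧-true (patch ρ f g) ⟨
        count (patch ρ f g ∧ᶠ const true)  ≡⟨ patch-count ρ f (const true)
                                                (sameChow-count-∧-const same true) ⟩
        count (f ∧ᶠ const true)            ≡⟨ count-∧-true f ⟩
        w f                                ∎)

lemma6 : (n : ℕ) (f : BoolFun n) → IsChow f →
         (ρ : Vec (Maybe Bool) n) → IsChow (restrict f ρ)
lemma6 n f chow ρ g same y = begin
  g y                     ≡⟨ patch-fill ρ f (extensional (free≤′ ρ) g) y ⟨
  patch ρ f g (fill ρ y)  ≡⟨ chow (patch ρ f g) (patch-sameChow (extensional z≤′n) ρ f same)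
                                  (fill ρ y) ⟩
  restrict f ρ y          ∎
  where
  extensional : ∀ {m} → m ≤′ n → (h : BoolFun m) → Extensional h
  extensional m≤′n =
    pointsDetermine⇒extensional (pointsDetermine-≤′ m≤′n (chow⇒pointsDetermine chow))
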